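{- Let $k$ be a positive integer. Let $G$ be a graph that is the join of finitely many cycles $C_m$ ($m\ge 3$) and crowns $C_m\odot K_1$ ($m\ge 3$), joined with at most one further graph which is a path, a comb, a triangular snake, or a quadrilateral snake. Then $G$ is a $k$-geometric mean graph.
   Context: In this paper the join $G_1+G_2$ of two graphs with disjoint vertex sets is their union (vertex set $V(G_1)\cup V(G_2)$, edge set $E(G_1)\cup E(G_2)$; no edges are added between them), so $G$ is the vertex-disjoint union of the listed components. The corona $G_1\odot G_2$ (with $G_1$ having $p$ vertices) is obtained from one copy of $G_1$ and $p$ copies of $G_2$ by joining the $i$-th vertex of $G_1$ to every vertex of the $i$-th copy of $G_2$; a crown is $C_m\odot K_1$ and a comb is $P_m\odot K_1$, where $P_m$, $C_m$ are the path and cycle on $m$ vertices. For a path $u_1\dots u_n$, the triangular snake $T_n$ adds for each $1\le i\le n-1$ a new vertex $v_i$ adjacent to $u_i$ and $u_{i+1}$; the quadrilateral snake $Q_n$ adds for each $1\le i\le n-1$ new vertices $v_i,w_i$ with edges $u_iv_i, v_iw_i, w_iu_{i+1}$. A graph $G$ with $p$ vertices and $q$ edges is a $k$-geometric mean graph if there is an injection $\psi: V(G)\to\{k,k+1,\dots,k+q\}$ such that, when each edge $uv$ is assigned one of the labels $\lfloor\sqrt{\psi(u)\psi(v)}\rfloor$ or $\lceil\sqrt{\psi(u)\psi(v)}\rceil$ (chosen per edge), the resulting set of edge labels is exactly $\{k,k+1,\dots,k+q-1\}$. -}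

module Defs where

open import Data.Nat using (ℕ; zero; suc; _+_; _*_; _∸_; _≤_; _<_)
open import Data.List using (List; []; _∷_; _++_; map; length; lookup; upTo; concatMap)
open import Data.Fin using (Fin)
open import Data.Product using (_×_; _,_; Σ; ∃)
open import Data.Sum using (_⊎_)
open import Data.Maybe using (Maybe; just; nothing)
open import Relation.Binary.PropositionalEquality using (_≡_)

-- A finite graph: vertices are 0 , 1 , … , V-1 ; edges are listed as pairs of vertices.
record Graph : Set where
  constructor mkGraph
  field
    V : ℕ
    E : List (ℕ × ℕ)
open Graph public

size : Graph → ℕ
size G = length (E G)

-- The paper's "join" G₁ + G₂: disjoint union (second graph's vertices shifted by V₁).
shiftE : ℕ → List (ℕ × ℕ) → List (ℕ × ℕ)
shiftE s = map (λ { (a , b) → (s + a , s + b) })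

_⊕_ : Graph → Graph → Graph
G ⊕ H = mkGraph (V G + V H) (E G ++ shiftE (V G) (E H))

emptyGraph : Graph
emptyGraph = mkGraph 0 []

pathEdges : ℕ → List (ℕ × ℕ)
pathEdges m = map (λ i → (i , suc i)) (upTo (m ∸ 1))

-- pendant edges i — (m+i), i < m  (the K₁ copies of a corona with K₁)
pendantEdges : ℕ → List (ℕ × ℕ)
pendantEdges m = map (λ i → (i , m + i)) (upTo m)

Path : ℕ → Graph
Path m = mkGraph m (pathEdges m)

Cycle : ℕ → Graph
Cycle m = mkGraph m (pathEdges m ++ ((m ∸ 1 , 0) ∷ []))

Crown : ℕ → Graph
Crown m = mkGraph (m + m) (E (Cycle m) ++ pendantEdges m)

Comb : ℕ → Graph
Comb m = mkGraph (m + m) (pathEdges m ++ pendantEdges m)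

-- triangular snake T_n : u_i = i (i < n), v_i = n + i (i < n-1)
TriSnake : ℕ → Graph
TriSnake n = mkGraph (n + (n ∸ 1))
  (pathEdges n ++ concatMap (λ i → (i , n + i) ∷ (n + i , suc i) ∷ []) (upTo (n ∸ 1)))

-- quadrilateral snake Q_n : u_i = i, v_i = n + i, w_i = n + (n-1) + i
QuadSnake : ℕ → Graph
QuadSnake n = mkGraph (n + (n ∸ 1) + (n ∸ 1))
  (pathEdges n ++ concatMap
     (λ i → (i , n + i) ∷ (n + i , n + (n ∸ 1) + i) ∷ (n + (n ∸ 1) + i , suc i) ∷ [])
     (upTo (n ∸ 1)))

data CycComp : Set where
  cycleC crownC : ℕ → CycComp

cycCompSize : CycComp → ℕ
cycCompSize (cycleC m) = m
cycCompSize (crownC m) = m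

cycCompGraph : CycComp → Graph
cycCompGraph (cycleC m) = Cycle m
cycCompGraph (crownC m) = Crown m

data ExtraComp : Set where
  pathC combC triC quadC : ℕ → ExtraComp

extraSize : ExtraComp → ℕ
extraSize (pathC m) = m
extraSize (combC m) = m
extraSize (triC n) = n
extraSize (quadC n) = n

extraGraph : ExtraComp → Graph
extraGraph (pathC m) = Path m
extraGraph (combC m) = Comb m
extraGraph (triC n) = TriSnake n
extraGraph (quadC n) = QuadSnake n

unionAll : List CycComp → Graph
unionAll [] = emptyGraph
unionAll (c ∷ cs) = cycCompGraph c ⊕ unionAll cs

buildGraph : List CycComp → Maybe ExtraComp → Graph
buildGraph cs nothing = unionAll cs
buildGraph cs (just x) = unionAll cs ⊕ extraGraph x

IsFloorSqrt : ℕ → ℕ → Set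
IsFloorSqrt x l = (l * l ≤ x) × (x < suc l * suc l)

IsCeilSqrt : ℕ → ℕ → Set
IsCeilSqrt x l = (x ≤ l * l) × (∀ m → x ≤ m * m → l ≤ m)

IsKGeometricMean : ℕ → Graph → Set
IsKGeometricMean k G =
  Σ (ℕ → ℕ) λ ψ →
    (∀ u v → u < V G → v < V G → ψ u ≡ ψ v → u ≡ v) ×
    (∀ v → v < V G → (k ≤ ψ v) × (ψ v ≤ k + size G)) ×
    Σ (Fin (size G) → ℕ) λ lab →
      (∀ i → let e = lookup (E G) i in
               let x = ψ (Data.Product.proj₁ e) * ψ (Data.Product.proj₂ e) in
               IsFloorSqrt x (lab i) ⊎ IsCeilSqrt x (lab i)) ×
      (∀ i → (k ≤ lab i) × (lab i < k + size G)) ×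
      (∀ l → k ≤ l → l < k + size G → ∃ λ i → lab i ≡ l)

module Submission where

-- A Labelling of a graph (below) is an injective vertex labelling ψ together with a list of edge
-- labels, one per edge, filling an interval [s, s + q); the vertex labels lie in [s, s + q)
-- ("slack 0") or [s, s + q] ("slack 1").  Labellings stack: a slack-0 labelling of G followed
-- by one of H starting at s + q labels G ⊕ H (stack), and a slack-1 labelling with floor or
-- ceiling edge labels starting at k is a k-geometric mean labelling (geometric-mean).  So it
-- suffices to label every cycle and crown with slack 0 and the last component with slack 1,
-- starting at an arbitrary s ≥ 1.
--
-- Paths, combs and the two snakes get explicit periodic labellings: the i-th vertex or edge of
-- class a < d is labelled s + a + d i, and the products along edges are near squares
-- (gap-succ, gap-succ², floor-plus3, floor-plus4).  Cycles and crowns come from paths and combs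
-- by close-edge: the closing edge gets c = ⌊√(ψ a ψ b)⌋ and every other label ≥ c moves up by
-- one, which stays admissible since every path and comb product lies strictly between two
-- consecutive squares.

open import Defs
open import Data.Nat using (ℕ; _≤_; _<_)
open import Data.List using (List)
open import Data.List.Relation.Unary.All using (All)
open import Data.Maybe using (Maybe)
open import Data.Maybe.Relation.Unary.All using () renaming (All to AllM)
open import Data.Nat
open import Data.Nat.Properties
open import Data.Nat.DivMod using (_%_; _/_; m%n<n; m<n⇒m%n≡m; [m+kn]%n≡m%n; m≡m%n+[m/n]*n)
open import Data.Nat.Tactic.RingSolver using (solve-∀)
open import Data.Fin as Fin using (Fin)
open import Data.Fin.Properties using (cast-involutive)
open import Data.List using (_∷_; []; _++_; map; lookup; upTo; length; concatMap)
open import Data.List.Properties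
  using (length-++; length-++-sucʳ; length-map; length-upTo; ++-assoc; ++-identityʳ)
open import Data.List.Relation.Unary.All as All using ([]; _∷_)
import Data.List.Relation.Unary.All.Properties as AllP
open import Data.List.Relation.Unary.Any as Any using (here; there)
open import Data.List.Relation.Unary.Any.Properties using (lookup-index)
open import Data.List.Relation.Binary.Pointwise as Pw using (Pointwise; []; _∷_; Pointwise-length)
open import Data.List.Membership.Propositional using (_∈_)
open import Data.List.Membership.Propositional.Properties
  using (∈-++⁺ˡ; ∈-++⁺ʳ; ∈-++⁻; ∈-map⁺; ∈-upTo⁺; ∈-concat⁺′)
open import Data.Maybe using (just; nothing)
open import Data.Maybe.Relation.Unary.All using (just; nothing)
open import Data.Product using (_×_; _,_; proj₁; proj₂; ∃; ∃₂)
open import Data.Sum using (_⊎_; inj₁; inj₂)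
open import Function using (id; _∘_)
open import Relation.Binary.Definitions using (tri<; tri≈; tri>)
open import Relation.Binary.PropositionalEquality
open import Relation.Nullary using (yes; no; contradiction)

Admissible : ℕ → ℕ → Set
Admissible x l = IsFloorSqrt x l ⊎ IsCeilSqrt x l

record StrictlyBetween (x b : ℕ) : Set where
  constructor strictly
  field
    above-square      : b * b < x
    below-next-square : x < suc b * suc b

strict⇒floor : ∀ {x b} → StrictlyBetween x b → IsFloorSqrt x b
strict⇒floor (strictly b²<x x<[b+1]²) = <⇒≤ b²<x , x<[b+1]²

strict⇒ceil : ∀ {x b} → StrictlyBetween x b → IsCeilSqrt x (suc b)
strict⇒ceil (strictly b²<x x<[b+1]²) =
  <⇒≤ x<[b+1]² ,
  λ m x≤m² → ≰⇒> (λ m≤b → <⇒≱ b²<x (≤-trans x≤m² (*-mono-≤ m≤b m≤b)))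

floor-by-gaps : ∀ {x l} a c → x ≡ l * l + a → suc l * suc l ≡ suc (x + c) → IsFloorSqrt x l
floor-by-gaps {x} {l} a c x≡ sq≡ =
  subst (l * l ≤_) (sym x≡) (m≤m+n _ a) , subst (suc x ≤_) (sym sq≡) (s≤s (m≤m+n x c))

strict-by-gaps : ∀ {x b} a c → x ≡ suc (b * b + a) → suc b * suc b ≡ suc (x + c) →
  StrictlyBetween x b
strict-by-gaps {x} {b} a c x≡ sq≡ =
  strictly (subst (b * b <_) (sym x≡) (s≤s (m≤m+n _ a)))
           (subst (suc x ≤_) (sym sq≡) (s≤s (m≤m+n x c)))

gap-succ : ∀ b → 1 ≤ b → StrictlyBetween (b * suc b) b
gap-succ (suc z) _ = strict-by-gaps z (suc z) (x≡ z) (sq≡ z)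
  where
  x≡ : ∀ z → suc z * suc (suc z) ≡ suc (suc z * suc z + z)
  x≡ = solve-∀
  sq≡ : ∀ z → suc (suc z) * suc (suc z) ≡ suc (suc z * suc (suc z) + suc z)
  sq≡ = solve-∀

gap-succ² : ∀ b → 1 ≤ b → StrictlyBetween (b * suc (suc b)) b
gap-succ² (suc z) _ = strict-by-gaps (suc (z + z)) 0 (x≡ z) (sq≡ z)
  where
  x≡ : ∀ z → suc z * suc (suc (suc z)) ≡ suc (suc z * suc z + suc (z + z))
  x≡ = solve-∀
  sq≡ : ∀ z → suc (suc z) * suc (suc z) ≡ suc (suc z * suc (suc (suc z)) + 0)
  sq≡ = solve-∀

floor-plus3 : ∀ b → 1 ≤ b → IsFloorSqrt (b * (3 + b)) (suc b)
floor-plus3 (suc z) _ = floor-by-gaps {l = 2 + z} z (4 + z) (x≡ z) (sq≡ z)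
  where
  x≡ : ∀ z → suc z * (4 + z) ≡ (2 + z) * (2 + z) + z
  x≡ = solve-∀
  sq≡ : ∀ z → (3 + z) * (3 + z) ≡ suc (suc z * (4 + z) + (4 + z))
  sq≡ = solve-∀

floor-plus4 : ∀ b → 1 ≤ b → IsFloorSqrt (b * (4 + b)) (suc b)
floor-plus4 (suc z) _ = floor-by-gaps {l = 2 + z} (suc (z + z)) 3 (x≡ z) (sq≡ z)
  where
  x≡ : ∀ z → suc z * (5 + z) ≡ (2 + z) * (2 + z) + suc (z + z)
  x≡ = solve-∀
  sq≡ : ∀ z → (3 + z) * (3 + z) ≡ suc (suc z * (5 + z) + 3)
  sq≡ = solve-∀

floor-sqrt : ∀ x → ∃ λ l → IsFloorSqrt x l
floor-sqrt zero = 0 , z≤n , s≤s z≤n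
floor-sqrt (suc x) with floor-sqrt x
... | l , l²≤x , x<[l+1]² with suc x <? suc l * suc l
...   | yes x+1<[l+1]² = l , m≤n⇒m≤1+n l²≤x , x+1<[l+1]²
...   | no  x+1≮[l+1]² = suc l , ≮⇒≥ x+1≮[l+1]² , x+1<[l+2]²
  where
  x+1≡[l+1]² : suc x ≡ suc l * suc l
  x+1≡[l+1]² = ≤-antisym x<[l+1]² (≮⇒≥ x+1≮[l+1]²)
  x+1<[l+2]² : suc x < suc (suc l) * suc (suc l)
  x+1<[l+2]² = subst (_< suc (suc l) * suc (suc l)) (sym x+1≡[l+1]²)
    (*-mono-< (n<1+n (suc l)) (n<1+n (suc l)))

floor-sqrt-between : ∀ {x c lo hi} → IsFloorSqrt x c → lo * lo ≤ x → x ≤ hi * hi →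
  lo ≤ c × c ≤ hi
floor-sqrt-between (c²≤x , x<[c+1]²) lo²≤x x≤hi² =
  ≮⇒≥ (λ c<lo → <⇒≱ x<[c+1]² (≤-trans (*-mono-≤ c<lo c<lo) lo²≤x)) ,
  ≮⇒≥ (λ hi<c → <⇒≱ (≤-<-trans x≤hi² (*-mono-< hi<c hi<c)) c²≤x)

juxtapose : ℕ → (ℕ → ℕ) → (ℕ → ℕ) → ℕ → ℕ
juxtapose n g h a with a <? n
... | yes _ = g a
... | no  _ = h (a ∸ n)

data Side (n m : ℕ) : ℕ → Set where
  left  : ∀ {u} → u < n → Side n m u
  right : ∀ {w} → w < m → Side n m (n + w)

side : ∀ n m u → u < n + m → Side n m u
side n m u u<n+m with u <? n
... | yes u<n = left u<n
... | no  u≮n = subst (Side n m) (m+[n∸m]≡n (≮⇒≥ u≮n)) (right (+-cancelˡ-< n _ _ u-n<m))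
  where
  u-n<m : n + (u ∸ n) < n + m
  u-n<m = subst (_< n + m) (sym (m+[n∸m]≡n (≮⇒≥ u≮n))) u<n+m

InjectiveBelow : ℕ → (ℕ → ℕ) → Set
InjectiveBelow n f = ∀ u v → u < n → v < n → f u ≡ f v → u ≡ v

module _ {n : ℕ} {g h : ℕ → ℕ} where

  juxtapose-left : ∀ {a} → a < n → juxtapose n g h a ≡ g a
  juxtapose-left {a} a<n with a <? n
  ... | yes _   = refl
  ... | no  a≮n = contradiction a<n a≮n

  juxtapose-right : ∀ a → juxtapose n g h (n + a) ≡ h a
  juxtapose-right a with n + a <? n
  ... | yes n+a<n = contradiction n+a<n (m+n≮m n a)
  ... | no  _     = cong h (m+n∸m≡n n a)

  side-label : ∀ {m u} → Side n m u → ℕ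
  side-label (left {u} _)  = g u
  side-label (right {w} _) = h w

  juxtapose-side : ∀ {m u} (σ : Side n m u) → juxtapose n g h u ≡ side-label σ
  juxtapose-side (left u<n)     = juxtapose-left u<n
  juxtapose-side (right {w} _)  = juxtapose-right w

  juxtapose-injective : ∀ m → InjectiveBelow n g → InjectiveBelow m h →
    (∀ u w → u < n → w < m → g u ≢ h w) → InjectiveBelow (n + m) (juxtapose n g h)
  juxtapose-injective m g-inj h-inj disjoint u v u< v< eq =
    by-sides σ τ (trans (sym (juxtapose-side σ)) (trans eq (juxtapose-side τ)))
    where
    σ = side n m u u<
    τ = side n m v v<
    by-sides : ∀ {u v} (σ : Side n m u) (τ : Side n m v) → side-label σ ≡ side-label τ → u ≡ v
    by-sides (left u<n)  (left v<n)   eq = g-inj _ _ u<n v<n eq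
    by-sides (left u<n)  (right w<m)  eq = contradiction eq (disjoint _ _ u<n w<m)
    by-sides (right w<m) (left v<n)   eq = contradiction (sym eq) (disjoint _ _ v<n w<m)
    by-sides (right w<m) (right w′<m) eq = cong (n +_) (h-inj _ _ w<m w′<m eq)

  juxtapose-all : ∀ {P : ℕ → Set} m →
    (∀ u → u < n → P (g u)) → (∀ w → w < m → P (h w)) →
    ∀ u → u < n + m → P (juxtapose n g h u)
  juxtapose-all {P} m Pg Ph u u< = subst P (sym (juxtapose-side σ)) (by-side σ)
    where
    σ = side n m u u<
    by-side : ∀ {u} (σ : Side n m u) → P (side-label σ)
    by-side (left u<n)     = Pg _ u<n
    by-side (right {w} w<m) = Ph w w<m

record EdgeOK (R : ℕ → ℕ → Set) (ψ : ℕ → ℕ) (n s q : ℕ) (e : ℕ × ℕ) (l : ℕ) : Set where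
  constructor edge-ok
  field
    source<     : proj₁ e < n
    target<     : proj₂ e < n
    related     : R (ψ (proj₁ e) * ψ (proj₂ e)) l
    label-lower : s ≤ l
    label-upper : l < s + q

record Labelling (R : ℕ → ℕ → Set) (slack s q : ℕ) (G : Graph) : Set where
  field
    edge-count  : size G ≡ q
    ψ           : ℕ → ℕ
    ψ-injective : InjectiveBelow (V G) ψ
    ψ-lower     : ∀ v → v < V G → s ≤ ψ v
    ψ-upper     : ∀ v → v < V G → ψ v < slack + (s + q)
    labels      : List ℕ
    edges-ok    : Pointwise (EdgeOK R ψ (V G) s q) (E G) labels
    labels-onto : ∀ l → s ≤ l → l < s + q → l ∈ labels

geometric-mean : ∀ {k q G} → Labelling Admissible 1 k q G → IsKGeometricMean k G
geometric-mean {k} {q} {G} L₀ =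
  ψ , ψ-injective , (λ v v< → ψ-lower v v< , s≤s⁻¹ (ψ-upper v v<)) ,
  lab , (λ i → EdgeOK.related (edge i)) ,
  (λ i → EdgeOK.label-lower (edge i) , EdgeOK.label-upper (edge i)) ,
  λ l k≤l l< → let l∈ = labels-onto l k≤l l< ; j = Any.index l∈ in
    Fin.cast (sym #labels) j ,
    trans (cong (lookup labels) (cast-involutive #labels (sym #labels) j)) (sym (lookup-index l∈))
  where
  L : Labelling Admissible 1 k (size G) G
  L = subst (λ q → Labelling Admissible 1 k q G) (sym (Labelling.edge-count L₀)) L₀
  open Labelling L
  #labels = Pointwise-length edges-ok
  lab : Fin (size G) → ℕ
  lab i = lookup labels (Fin.cast #labels i)
  edge : ∀ i → EdgeOK Admissible ψ (V G) k (size G) (lookup (E G) i) (lab i)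
  edge = Pw.lookup⁺ edges-ok

relabel : ∀ {R S e s q G} → (∀ {x l} → R x l → S x l) → Labelling R e s q G → Labelling S e s q G
relabel {R} {S} {e} {s} {q} {G} R⇒S L = record { Labelling L ; edges-ok = Pw.map weaken edges-ok }
  where
  open Labelling L
  weaken : ∀ {x l} → EdgeOK R ψ (V G) s q x l → EdgeOK S ψ (V G) s q x l
  weaken (edge-ok a< b< r s≤l l<) = edge-ok a< b< (R⇒S r) s≤l l<

add-slack : ∀ {R s q G} → Labelling R 0 s q G → Labelling R 1 s q G
add-slack L = record { Labelling L ; ψ-upper = λ v v< → m≤n⇒m≤1+n (Labelling.ψ-upper L v v<) }

empty-labelling : ∀ {R} s → Labelling R 0 s 0 emptyGraph
empty-labelling s = record
  { edge-count = refl ; ψ = λ _ → s ; ψ-injective = λ _ _ () ; ψ-lower = λ _ () ; ψ-upper = λ _ ()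
  ; labels = [] ; edges-ok = []
  ; labels-onto = λ l s≤l l<s+0 → contradiction (subst (l <_) (+-identityʳ s) l<s+0) (≤⇒≯ s≤l)
  }

shiftE⁺ : ∀ {P : ℕ × ℕ → ℕ → Set} n {es ls} →
  Pointwise (λ e l → P (n + proj₁ e , n + proj₂ e) l) es ls → Pointwise P (shiftE n es) ls
shiftE⁺ n []       = []
shiftE⁺ n (p ∷ ps) = p ∷ shiftE⁺ n ps

stack : ∀ {R e s q₁ q₂ G H} → Labelling R 0 s q₁ G → Labelling R e (s + q₁) q₂ H →
  Labelling R e s (q₁ + q₂) (G ⊕ H)
stack {R} {e} {s} {q₁} {q₂} {G} {H} LG LH = record
  { edge-count  = trans (length-++ (E G)) (cong₂ _+_ G.edge-count (trans (length-map _ (E H)) H.edge-count))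
  ; ψ           = ψ
  ; ψ-injective = juxtapose-injective {V G} {G.ψ} {H.ψ} (V H) G.ψ-injective H.ψ-injective
      λ u w u< w< → <⇒≢ (<-≤-trans (G.ψ-upper u u<) (H.ψ-lower w w<))
  ; ψ-lower     = juxtapose-all {V G} {G.ψ} {H.ψ} {s ≤_} (V H) G.ψ-lower
      λ w w< → ≤-trans (m≤m+n s q₁) (H.ψ-lower w w<)
  ; ψ-upper     = juxtapose-all {V G} {G.ψ} {H.ψ} {_< e + (s + (q₁ + q₂))} (V H)
      (λ u u< → <-≤-trans (G.ψ-upper u u<) (≤-trans (+-monoʳ-≤ s (m≤m+n q₁ q₂)) (m≤n+m _ e)))
      (λ w w< → subst (H.ψ w <_) (cong (e +_) (+-assoc s q₁ q₂)) (H.ψ-upper w w<))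
  ; labels      = G.labels ++ H.labels
  ; edges-ok    = Pw.++⁺ (Pw.map from-G G.edges-ok) (shiftE⁺ (V G) (Pw.map from-H H.edges-ok))
  ; labels-onto = onto
  }
  where
  module G = Labelling LG
  module H = Labelling LH
  ψ = juxtapose (V G) G.ψ H.ψ
  ψ-left  = juxtapose-left {V G} {G.ψ} {H.ψ}
  ψ-right = juxtapose-right {V G} {G.ψ} {H.ψ}
  from-G : ∀ {x l} → EdgeOK R G.ψ (V G) s q₁ x l → EdgeOK R ψ (V G + V H) s (q₁ + q₂) x l
  from-G {a , b} {l} (edge-ok a< b< r s≤l l<) = edge-ok
    (≤-trans a< (m≤m+n _ _)) (≤-trans b< (m≤m+n _ _))
    (subst (λ x → R x l) (sym (cong₂ _*_ (ψ-left a<) (ψ-left b<))) r)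
    s≤l (<-≤-trans l< (+-monoʳ-≤ s (m≤m+n q₁ q₂)))
  from-H : ∀ {x l} → EdgeOK R H.ψ (V H) (s + q₁) q₂ x l →
    EdgeOK R ψ (V G + V H) s (q₁ + q₂) (V G + proj₁ x , V G + proj₂ x) l
  from-H {a , b} {l} (edge-ok a< b< r s+q₁≤l l<) = edge-ok
    (+-monoʳ-< (V G) a<) (+-monoʳ-< (V G) b<)
    (subst (λ x → R x l) (sym (cong₂ _*_ (ψ-right a) (ψ-right b))) r)
    (≤-trans (m≤m+n s q₁) s+q₁≤l) (subst (l <_) (+-assoc s q₁ q₂) l<)
  onto : ∀ l → s ≤ l → l < s + (q₁ + q₂) → l ∈ G.labels ++ H.labels
  onto l s≤l l< with l <? s + q₁
  ... | yes l<s+q₁ = ∈-++⁺ˡ (G.labels-onto l s≤l l<s+q₁)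
  ... | no  l≮s+q₁ =
    ∈-++⁺ʳ G.labels (H.labels-onto l (≮⇒≥ l≮s+q₁) (subst (l <_) (sym (+-assoc s q₁ q₂)) l<))

-- skip c b = b below c and b + 1 from c on: it moves the labels [s, s + N) onto [s, s + N] ∖ {c}.
skip : ℕ → ℕ → ℕ
skip c b with b <? c
... | yes _ = b
... | no  _ = suc b

skip-below : ∀ {c b} → b < c → skip c b ≡ b
skip-below {c} {b} b<c with b <? c
... | yes _   = refl
... | no  b≮c = contradiction b<c b≮c

skip-above : ∀ {c b} → c ≤ b → skip c b ≡ suc b
skip-above {c} {b} c≤b with b <? c
... | yes b<c = contradiction c≤b (<⇒≱ b<c)
... | no  _   = refl

skip-bounds : ∀ c b → b ≤ skip c b × skip c b ≤ suc b
skip-bounds c b with b <? c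
... | yes _ = ≤-refl , n≤1+n b
... | no  _ = n≤1+n b , ≤-refl

-- A product strictly between b² and (b+1)² admits both b and b + 1, so any skip c b is admissible.
skip-admissible : ∀ c {x b} → StrictlyBetween x b → Admissible x (skip c b)
skip-admissible c {b = b} strict with b <? c
... | yes _ = inj₁ (strict⇒floor strict)
... | no  _ = inj₂ (strict⇒ceil strict)

skip-onto : ∀ {c s N} l → s ≤ c → c ≤ s + N → s ≤ l → l < suc (s + N) → l ≢ c →
  ∃ λ b → s ≤ b × b < s + N × skip c b ≡ l
skip-onto {c} l s≤c c≤s+N s≤l l≤s+N l≢c with <-cmp l c
... | tri< l<c _ _ = l , s≤l , <-≤-trans l<c c≤s+N , skip-below l<c
... | tri≈ _ l≡c _ = contradiction l≡c l≢c
skip-onto (suc b) s≤c _ _ l≤s+N _ | tri> _ _ c<l =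
  b , ≤-trans s≤c (s≤s⁻¹ c<l) , s≤s⁻¹ l≤s+N , skip-above (s≤s⁻¹ c<l)

pointwise-split : ∀ {R : ℕ × ℕ → ℕ → Set} xs {ys ls} → Pointwise R (xs ++ ys) ls →
  ∃₂ λ lx ly → ls ≡ lx ++ ly × Pointwise R xs lx × Pointwise R ys ly
pointwise-split []       p       = [] , _ , refl , [] , p
pointwise-split (x ∷ xs) (r ∷ p) with pointwise-split xs p
... | lx , ly , refl , px , py = _ ∷ lx , ly , refl , r ∷ px , py

pointwise-mapʳ : ∀ {R S : ℕ × ℕ → ℕ → Set} {g : ℕ → ℕ} →
  (∀ {e l} → R e l → S e (g l)) → ∀ {es ls} → Pointwise R es ls → Pointwise S es (map g ls)
pointwise-mapʳ f []       = []
pointwise-mapʳ f (r ∷ rs) = f r ∷ pointwise-mapʳ f rs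

-- Insert into a strict labelling (slack 1) an
-- edge (a , b); label it c = ⌊√(ψ a ψ b)⌋ ∈ [s, s + q] and shift every other label b to skip c b.
close-edge : ∀ {s q} G xs ys {a b} → E G ≡ xs ++ ys → a < V G → b < V G →
  Labelling StrictlyBetween 1 s q G → Labelling Admissible 0 s (suc q) (mkGraph (V G) (xs ++ (a , b) ∷ ys))
close-edge {s} {q} G xs ys {a} {b} E≡ a< b< L = record
  { edge-count  = trans (length-++-sucʳ xs (a , b) ys) (cong suc (trans (cong length (sym E≡)) edge-count))
  ; ψ           = ψ
  ; ψ-injective = ψ-injective
  ; ψ-lower     = ψ-lower
  ; ψ-upper     = λ v v< → subst (ψ v <_) (sym (+-suc s q)) (ψ-upper v v<)
  ; labels      = map (skip c) lx ++ c ∷ map (skip c) ly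
  ; edges-ok    = Pw.++⁺ (pointwise-mapʳ shifted px) (closing ∷ pointwise-mapʳ shifted py)
  ; labels-onto = onto
  }
  where
  open Labelling L
  c = proj₁ (floor-sqrt (ψ a * ψ b))
  c-floor = proj₂ (floor-sqrt (ψ a * ψ b))
  split = pointwise-split xs (subst (λ es → Pointwise _ es labels) E≡ edges-ok)
  lx = proj₁ split
  ly = proj₁ (proj₂ split)
  labels≡ = proj₁ (proj₂ (proj₂ split))
  px = proj₁ (proj₂ (proj₂ (proj₂ split)))
  py = proj₂ (proj₂ (proj₂ (proj₂ split)))
  s+q+1≡ : suc (s + q) ≡ s + suc q
  s+q+1≡ = sym (+-suc s q)
  c-bounds : s ≤ c × c ≤ s + q
  c-bounds = floor-sqrt-between c-floor (*-mono-≤ (ψ-lower a a<) (ψ-lower b b<))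
    (*-mono-≤ (s≤s⁻¹ (ψ-upper a a<)) (s≤s⁻¹ (ψ-upper b b<)))
  closing : EdgeOK Admissible ψ (V G) s (suc q) (a , b) c
  closing = edge-ok a< b< (inj₁ c-floor) (proj₁ c-bounds) (subst (c <_) s+q+1≡ (s≤s (proj₂ c-bounds)))
  shifted : ∀ {e l} → EdgeOK StrictlyBetween ψ (V G) s q e l →
    EdgeOK Admissible ψ (V G) s (suc q) e (skip c l)
  shifted {l = l} (edge-ok u< v< strict s≤l l<) = edge-ok
    u< v< (skip-admissible c strict) (≤-trans s≤l (proj₁ (skip-bounds c l)))
    (subst (skip c l <_) s+q+1≡ (s≤s (≤-trans (proj₂ (skip-bounds c l)) l<)))
  onto : ∀ l → s ≤ l → l < s + suc q → l ∈ map (skip c) lx ++ c ∷ map (skip c) ly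
  onto l s≤l l< with l ≟ c
  ... | yes l≡c = ∈-++⁺ʳ (map (skip c) lx) (here l≡c)
  ... | no  l≢c with skip-onto l (proj₁ c-bounds) (proj₂ c-bounds) s≤l (subst (l <_) (sym s+q+1≡) l<)
                               l≢c
  ...   | t , s≤t , t< , skip≡l with ∈-++⁻ lx (subst (t ∈_) labels≡ (labels-onto t s≤t t<))
  ...     | inj₁ t∈lx = subst (_∈ _) skip≡l (∈-++⁺ˡ (∈-map⁺ (skip c) t∈lx))
  ...     | inj₂ t∈ly =
    subst (_∈ _) skip≡l (∈-++⁺ʳ (map (skip c) lx) (there (∈-map⁺ (skip c) t∈ly)))

-- The label of the i-th vertex or edge of class a < d in a layout of period d starting at s.
residue : ℕ → ℕ → ℕ → ℕ → ℕ
residue s d a i = s + (a + i * d)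

residue-class : ∀ s d a i → residue s d a i ≡ a + residue s d 0 i
residue-class s d a i = shift s a (i * d)
  where
  shift : ∀ s a x → s + (a + x) ≡ a + (s + x)
  shift = solve-∀

residue-next-index : ∀ s d a i → residue s d a (suc i) ≡ d + residue s d a i
residue-next-index s d a i = step s d a i
  where
  step : ∀ s d a i → s + (a + (d + i * d)) ≡ d + (s + (a + i * d))
  step = solve-∀

-- Division with remainder: class and index are determined by the label.
residue-injective : ∀ s d .{{_ : NonZero d}} {a b i j} → a < d → b < d →
  residue s d a i ≡ residue s d b j → a ≡ b × i ≡ j
residue-injective s d {a} {b} {i} {j} a<d b<d eq =
  a≡b , *-cancelʳ-≡ i j d (+-cancelˡ-≡ a _ _ offsets≡′)
  where
  offsets≡ : a + i * d ≡ b + j * d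
  offsets≡ = +-cancelˡ-≡ s _ _ eq
  open ≡-Reasoning
  a≡b : a ≡ b
  a≡b = begin
    a                ≡⟨ sym (m<n⇒m%n≡m a<d) ⟩
    a % d            ≡⟨ sym ([m+kn]%n≡m%n a i d) ⟩
    (a + i * d) % d  ≡⟨ cong (_% d) offsets≡ ⟩
    (b + j * d) % d  ≡⟨ [m+kn]%n≡m%n b j d ⟩
    b % d            ≡⟨ m<n⇒m%n≡m b<d ⟩
    b                ∎
  offsets≡′ : a + i * d ≡ a + j * d
  offsets≡′ = trans offsets≡ (cong (_+ j * d) (sym a≡b))

residue-index-injective : ∀ s d .{{_ : NonZero d}} {a} n → a < d → InjectiveBelow n (residue s d a)
residue-index-injective s d n a<d i j _ _ eq = proj₂ (residue-injective s d {i = i} {j} a<d a<d eq)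

residue-disjoint : ∀ s d .{{_ : NonZero d}} {a b} → a < d → b < d → a ≢ b →
  ∀ i j → residue s d a i ≢ residue s d b j
residue-disjoint s d a<d b<d a≢b i j eq = a≢b (proj₁ (residue-injective s d {i = i} {j} a<d b<d eq))

offset-below : ∀ {d a i n} → i < n → a < d → a + i * d < n * d
offset-below {d} {i = i} i<n a<d = <-≤-trans (+-monoˡ-< (i * d) a<d) (*-monoˡ-≤ d i<n)

offset-index : ∀ {d a i n} .{{_ : NonZero d}} → a + i * d < n * d → i < n
offset-index {d} {a} {i} {n} a+id<nd = *-cancelʳ-< d i n (≤-<-trans (m≤n+m (i * d) a) a+id<nd)

onto-by-offsets : ∀ {s q} {ls : List ℕ} → (∀ t → t < q → s + t ∈ ls) →
  ∀ l → s ≤ l → l < s + q → l ∈ ls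
onto-by-offsets {s} {q} {ls} hit l s≤l l<s+q = subst (_∈ ls) s+t≡l (hit t (+-cancelˡ-< s t q s+t<s+q))
  where
  t = l ∸ s
  s+t≡l = m+[n∸m]≡n s≤l
  s+t<s+q = subst (_< s + q) (sym s+t≡l) l<s+q

onto-by-residues : ∀ {s q} d .{{_ : NonZero d}} {ls : List ℕ} →
  (∀ a i → a < d → a + i * d < q → residue s d a i ∈ ls) →
  ∀ l → s ≤ l → l < s + q → l ∈ ls
onto-by-residues {s} {q} d {ls} hit = onto-by-offsets λ t t<q →
  subst (λ x → s + x ∈ ls) (sym (t≡ t)) (hit (t % d) (t / d) (m%n<n t d) (subst (_< q) (t≡ t) t<q))
  where
  t≡ : ∀ t → t ≡ t % d + (t / d) * d
  t≡ t = m≡m%n+[m/n]*n t d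

length-family : ∀ {A : Set} (f : ℕ → A) n → length (map f (upTo n)) ≡ n
length-family f n = trans (length-map f (upTo n)) (length-upTo n)

length-blocks : ∀ {A : Set} (f : ℕ → List A) k → (∀ i → length (f i) ≡ k) → ∀ n →
  length (concatMap f (upTo n)) ≡ n * k
length-blocks f k |f|≡k n = trans (go (upTo n)) (cong (_* k) (length-upTo n))
  where
  go : ∀ xs → length (concatMap f xs) ≡ length xs * k
  go []       = refl
  go (x ∷ xs) = trans (length-++ (f x)) (cong₂ _+_ (|f|≡k x) (go xs))

pointwise-upTo : ∀ {A B : Set} {R : A → B → Set} {f : ℕ → A} {g : ℕ → B} n →
  (∀ {i} → i < n → R (f i) (g i)) → Pointwise R (map f (upTo n)) (map g (upTo n))
pointwise-upTo {R = R} {f} {g} n Rfg = Pw.map⁺ f g (diagonal (AllP.applyUpTo⁺₁ id n Rfg))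
  where
  diagonal : ∀ {xs} → All (λ i → R (f i) (g i)) xs → Pointwise (λ i j → R (f i) (g j)) xs xs
  diagonal []         = []
  diagonal (px ∷ pxs) = px ∷ diagonal pxs

edge-via : ∀ {R : ℕ → ℕ → Set} {ψ n s q a b x y l} → ψ a ≡ x → ψ b ≡ y →
  a < n → b < n → R (x * y) l → s ≤ l → l < s + q → EdgeOK R ψ n s q (a , b) l
edge-via refl refl = edge-ok

-- Labels in a layout starting at s ≥ 1 are positive, as the near-square facts require.
residue-positive : ∀ {s} d a i → 1 ≤ s → 1 ≤ residue s d a i
residue-positive {s} d a i 1≤s = ≤-trans 1≤s (m≤m+n s (a + i * d))

-- The path P_{r+1}: vertex j and edge (j, j+1) both get s + j; the products (s+j)(s+j+1) are strict.
path-labelling : ∀ s r → 1 ≤ s → Labelling StrictlyBetween 1 s r (Path (suc r))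
path-labelling s r 1≤s = record
  { edge-count  = length-family _ r
  ; ψ           = s +_
  ; ψ-injective = λ u v _ _ → +-cancelˡ-≡ s u v
  ; ψ-lower     = λ v _ → m≤m+n s v
  ; ψ-upper     = λ v v< → subst (s + v <_) (+-suc s r) (+-monoʳ-< s v<)
  ; labels      = map (s +_) (upTo r)
  ; edges-ok    = pointwise-upTo r edge
  ; labels-onto = onto-by-offsets λ t t<r → ∈-map⁺ (s +_) (∈-upTo⁺ t<r)
  }
  where
  edge : ∀ {i} → i < r → EdgeOK StrictlyBetween (s +_) (suc r) s r (i , suc i) (s + i)
  edge {i} i<r = edge-via refl (+-suc s i) (m<n⇒m<1+n i<r) (s≤s i<r)
    (gap-succ (s + i) (≤-trans 1≤s (m≤m+n s i))) (m≤m+n s i) (+-monoʳ-< s i<r)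

-- The comb P_{r+1} ⊙ K₁: spine vertex j gets the odd label s + 1 + 2j, its pendant the even label
-- s + 2j.  Spine edge j is labelled s + 1 + 2j (product b(b+2)), pendant edge j s + 2j (product (b+1)b).
comb-labelling : ∀ s r → 1 ≤ s → Labelling StrictlyBetween 1 s (suc (r * 2)) (Comb (suc r))
comb-labelling s r 1≤s = record
  { edge-count  = trans (length-++ (pathEdges m))
      (trans (cong₂ _+_ (length-family _ r) (length-family _ m)) (count r))
  ; ψ           = ψ
  ; ψ-injective = juxtapose-injective {m} {spine} {pendant} m (residue-index-injective s 2 m 1<2)
      (residue-index-injective s 2 m 0<2) λ u w _ _ → residue-disjoint s 2 1<2 0<2 (λ ()) u w
  ; ψ-lower     = juxtapose-all {m} {spine} {pendant} {s ≤_} m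
      (λ _ _ → m≤m+n s _) (λ _ _ → m≤m+n s _)
  ; ψ-upper     = juxtapose-all {m} {spine} {pendant} {_< suc (s + q)} m
      (λ u u<m → vertex-bound u<m 1<2) (λ w w<m → vertex-bound w<m 0<2)
  ; labels      = map spine (upTo r) ++ map pendant (upTo m)
  ; edges-ok    = Pw.++⁺ (pointwise-upTo r spine-edge) (pointwise-upTo m pendant-edge)
  ; labels-onto = onto-by-residues 2 hit
  }
  where
  m = suc r
  q = suc (r * 2)
  count : ∀ r → r + suc r ≡ suc (r * 2)
  count = solve-∀
  1<2 : 1 < 2
  1<2 = s≤s (s≤s z≤n)
  0<2 : 0 < 2
  0<2 = s≤s z≤n
  spine pendant : ℕ → ℕ
  spine   = residue s 2 1
  pendant = residue s 2 0
  ψ = juxtapose m spine pendant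
  ψ-spine   = juxtapose-left {m} {spine} {pendant}
  ψ-pendant = juxtapose-right {m} {spine} {pendant}
  vertex-bound : ∀ {a u} → u < m → a < 2 → residue s 2 a u < suc (s + q)
  vertex-bound {a} {u} u<m a<2 = subst (residue s 2 a u <_) (+-suc s q) (+-monoʳ-< s (offset-below u<m a<2))
  spine-edge : ∀ {j} → j < r → EdgeOK StrictlyBetween ψ (m + m) s q (j , suc j) (spine j)
  spine-edge {j} j<r = edge-via (ψ-spine (m<n⇒m<1+n j<r))
    (trans (ψ-spine (s≤s j<r)) (residue-next-index s 2 1 j))
    (≤-trans (m<n⇒m<1+n j<r) (m≤m+n m m)) (≤-trans (s≤s j<r) (m≤m+n m m))
    (gap-succ² (spine j) (residue-positive 2 1 j 1≤s)) (m≤m+n s _)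
    (≤-trans (+-monoʳ-< s (offset-below j<r 1<2)) (+-monoʳ-≤ s (n≤1+n _)))
  pendant-edge : ∀ {j} → j < m → EdgeOK StrictlyBetween ψ (m + m) s q (j , m + j) (pendant j)
  pendant-edge {j} j<m = edge-via (trans (ψ-spine j<m) (residue-class s 2 1 j)) (ψ-pendant j)
    (≤-trans j<m (m≤m+n m m)) (+-monoʳ-< m j<m)
    (subst (λ x → StrictlyBetween x (pendant j)) (*-comm (pendant j) _)
      (gap-succ (pendant j) (residue-positive 2 0 j 1≤s)))
    (m≤m+n s _)
    (+-monoʳ-< s (s≤s (*-monoˡ-≤ 2 (s≤s⁻¹ j<m))))
  hit : ∀ a i → a < 2 → a + i * 2 < q → residue s 2 a i ∈ map spine (upTo r) ++ map pendant (upTo m)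
  hit 0 i _ 2i<q   = ∈-++⁺ʳ (map spine (upTo r))
    (∈-map⁺ pendant (∈-upTo⁺ (offset-index {2} {0} {i} {m} (m<n⇒m<1+n 2i<q))))
  hit 1 i _ 1+2i<q = ∈-++⁺ˡ
    (∈-map⁺ spine (∈-upTo⁺ (offset-index {2} {0} {i} {r} (s≤s⁻¹ 1+2i<q))))
  hit (suc (suc a)) i (s≤s (s≤s ())) _

cycle-labelling : ∀ s m → 1 ≤ s → 1 ≤ m → Labelling Admissible 0 s m (Cycle m)
cycle-labelling s (suc r) 1≤s _ =
  close-edge (Path (suc r)) (pathEdges (suc r)) [] (sym (++-identityʳ _)) (n<1+n r) z<s
    (path-labelling s r 1≤s)

crown-labelling : ∀ s m → 1 ≤ s → 1 ≤ m → Labelling Admissible 0 s (m * 2) (Crown m)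
crown-labelling s (suc r) 1≤s _ =
  subst (λ es → Labelling Admissible 0 s (suc r * 2) (mkGraph (suc r + suc r) es))
    (sym (++-assoc (pathEdges (suc r)) _ (pendantEdges (suc r))))
    (close-edge (Comb (suc r)) (pathEdges (suc r)) (pendantEdges (suc r)) refl
       (≤-trans (n<1+n r) (m≤m+n (suc r) (suc r))) z<s (comb-labelling s r 1≤s))

snake-labels : (ℕ → ℕ) → (ℕ → List ℕ) → ℕ → List ℕ
snake-labels spine block r = map spine (upTo r) ++ concatMap block (upTo r)

∈-spine : ∀ {spine block r i} → i < r → spine i ∈ snake-labels spine block r
∈-spine {spine} i<r = ∈-++⁺ˡ (∈-map⁺ spine (∈-upTo⁺ i<r))

∈-block : ∀ {spine block r i x} → i < r → x ∈ block i → x ∈ snake-labels spine block r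
∈-block {spine} {block} {r} i<r x∈ =
  ∈-++⁺ʳ (map spine (upTo r)) (∈-concat⁺′ x∈ (∈-map⁺ block (∈-upTo⁺ i<r)))

-- The triangular snake T_{r+1}, period 3 with base b = s + 3i: u_i gets b, v_i gets b + 1; the
-- edges u_i v_i, u_i u_{i+1}, v_i u_{i+1} get b = ⌊√(b(b+1))⌋, b + 1 = ⌊√(b(b+3))⌋ and
-- b + 2 = ⌈√((b+1)(b+3))⌉.
tri-labelling : ∀ s r → 1 ≤ s → Labelling Admissible 1 s (r * 3) (TriSnake (suc r))
tri-labelling s r 1≤s = record
  { edge-count  = trans (length-++ (pathEdges n))
      (trans (cong₂ _+_ (length-family _ r) (length-blocks _ 2 (λ _ → refl) r)) (count r))
  ; ψ           = ψ
  ; ψ-injective = juxtapose-injective {n} {u} {v} r (residue-index-injective s 3 n 0<3)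
      (residue-index-injective s 3 r 1<3) λ i j _ _ → residue-disjoint s 3 0<3 1<3 (λ ()) i j
  ; ψ-lower     = juxtapose-all {n} {u} {v} {s ≤_} r (λ _ _ → m≤m+n s _) (λ _ _ → m≤m+n s _)
  ; ψ-upper     = juxtapose-all {n} {u} {v} {_< suc (s + r * 3)} r
      (λ i i<n → s≤s (+-monoʳ-≤ s (*-monoˡ-≤ 3 (s≤s⁻¹ i<n))))
      (λ i i<r → m<n⇒m<1+n (+-monoʳ-< s (offset-below i<r 1<3)))
  ; labels      = snake-labels spine block r
  ; edges-ok    = Pw.++⁺ (pointwise-upTo r spine-edge)
      (Pw.concat⁺ (pointwise-upTo r λ i<r → foot-edge i<r ∷ apex-edge i<r ∷ []))
  ; labels-onto = onto-by-residues 3 hit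
  }
  where
  n = suc r
  count : ∀ r → r + r * 2 ≡ r * 3
  count = solve-∀
  0<3 : 0 < 3
  0<3 = s≤s z≤n
  1<3 : 1 < 3
  1<3 = s≤s (s≤s z≤n)
  2<3 : 2 < 3
  2<3 = ≤-refl
  -- vertex labels of u_i and v_i; the spine edge u_i u_{i+1} carries the label of v_i
  u v spine : ℕ → ℕ
  u     = residue s 3 0
  v     = residue s 3 1
  spine = v
  block : ℕ → List ℕ
  block i = residue s 3 0 i ∷ residue s 3 2 i ∷ []
  ψ = juxtapose n u v
  ψ-u = juxtapose-left {n} {u} {v}
  ψ-v = juxtapose-right {n} {u} {v}
  b≥1 : ∀ i → 1 ≤ u i
  b≥1 i = residue-positive 3 0 i 1≤s
  label< : ∀ {a i} → a < 3 → i < r → residue s 3 a i < s + r * 3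
  label< a<3 i<r = +-monoʳ-< s (offset-below i<r a<3)
  u< : ∀ {i} → i < n → i < n + r
  u< i<n = ≤-trans i<n (m≤m+n n r)
  spine-edge : ∀ {i} → i < r → EdgeOK Admissible ψ (n + r) s (r * 3) (i , suc i) (spine i)
  spine-edge {i} i<r = edge-via (ψ-u (m<n⇒m<1+n i<r)) (trans (ψ-u (s≤s i<r)) (residue-next-index s 3 0 i))
    (u< (m<n⇒m<1+n i<r)) (u< (s≤s i<r))
    (inj₁ (subst (IsFloorSqrt _) (sym (residue-class s 3 1 i)) (floor-plus3 (u i) (b≥1 i))))
    (m≤m+n s _) (label< 1<3 i<r)
  foot-edge : ∀ {i} → i < r → EdgeOK Admissible ψ (n + r) s (r * 3) (i , n + i) (residue s 3 0 i)
  foot-edge {i} i<r = edge-via (ψ-u (m<n⇒m<1+n i<r)) (trans (ψ-v i) (residue-class s 3 1 i))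
    (u< (m<n⇒m<1+n i<r)) (+-monoʳ-< n i<r)
    (inj₁ (strict⇒floor (gap-succ (u i) (b≥1 i))))
    (m≤m+n s _) (label< 0<3 i<r)
  apex-edge : ∀ {i} → i < r → EdgeOK Admissible ψ (n + r) s (r * 3) (n + i , suc i) (residue s 3 2 i)
  apex-edge {i} i<r = edge-via (trans (ψ-v i) (residue-class s 3 1 i))
    (trans (ψ-u (s≤s i<r)) (residue-next-index s 3 0 i))
    (+-monoʳ-< n i<r) (u< (s≤s i<r))
    (inj₂ (subst (IsCeilSqrt _) (sym (residue-class s 3 2 i))
      (strict⇒ceil (gap-succ² (suc (u i)) (s≤s z≤n)))))
    (m≤m+n s _) (label< 2<3 i<r)
  hit : ∀ a i → a < 3 → a + i * 3 < r * 3 → residue s 3 a i ∈ snake-labels spine block r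
  hit a i a<3 a+3i< = in-period a a<3 (offset-index {3} {a} {i} {r} a+3i<)
    where
    in-period : ∀ a → a < 3 → i < r → residue s 3 a i ∈ snake-labels spine block r
    in-period 0 _ i<r = ∈-block i<r (here refl)
    in-period 1 _ i<r = ∈-spine i<r
    in-period 2 _ i<r = ∈-block i<r (there (here refl))
    in-period (suc (suc (suc _))) (s≤s (s≤s (s≤s ()))) _

-- The quadrilateral snake Q_{r+1}, period 4 with base b = s + 4i: u_i, v_i, w_i get b, b + 1, b + 2;
-- the edges u_i v_i, u_i u_{i+1}, v_i w_i, w_i u_{i+1} get b = ⌊√(b(b+1))⌋, b + 1 = ⌊√(b(b+4))⌋,
-- b + 2 = ⌈√((b+1)(b+2))⌉, b + 3 = ⌈√((b+2)(b+4))⌉.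
quad-labelling : ∀ s r → 1 ≤ s → Labelling Admissible 1 s (r * 4) (QuadSnake (suc r))
quad-labelling s r 1≤s = record
  { edge-count  = trans (length-++ (pathEdges n))
      (trans (cong₂ _+_ (length-family _ r) (length-blocks _ 3 (λ _ → refl) r)) (count r))
  ; ψ           = ψ
  ; ψ-injective = juxtapose-injective {n + r} {ψ-uv} {w} r
      (juxtapose-injective {n} {u} {v} r (residue-index-injective s 4 n 0<4)
         (residue-index-injective s 4 r 1<4) λ i j _ _ → residue-disjoint s 4 0<4 1<4 (λ ()) i j)
      (residue-index-injective s 4 r 2<4)
      λ i j i< _ → juxtapose-all {n} {u} {v} {_≢ w j} r
        (λ i _ → residue-disjoint s 4 0<4 2<4 (λ ()) i j)
        (λ i _ → residue-disjoint s 4 1<4 2<4 (λ ()) i j) i i<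
  ; ψ-lower     = juxtapose-all {n + r} {ψ-uv} {w} {s ≤_} r
      (juxtapose-all {n} {u} {v} {s ≤_} r (λ _ _ → m≤m+n s _) (λ _ _ → m≤m+n s _))
      (λ _ _ → m≤m+n s _)
  ; ψ-upper     = juxtapose-all {n + r} {ψ-uv} {w} {_< suc (s + r * 4)} r
      (juxtapose-all {n} {u} {v} {_< suc (s + r * 4)} r
        (λ i i<n → s≤s (+-monoʳ-≤ s (*-monoˡ-≤ 4 (s≤s⁻¹ i<n))))
        (λ i i<r → m<n⇒m<1+n (label< 1<4 i<r)))
      (λ i i<r → m<n⇒m<1+n (label< 2<4 i<r))
  ; labels      = snake-labels spine block r
  ; edges-ok    = Pw.++⁺ (pointwise-upTo r spine-edge)
      (Pw.concat⁺ (pointwise-upTo r λ i<r → foot-edge i<r ∷ middle-edge i<r ∷ back-edge i<r ∷ []))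
  ; labels-onto = onto-by-residues 4 hit
  }
  where
  n = suc r
  count : ∀ r → r + r * 3 ≡ r * 4
  count = solve-∀
  0<4 : 0 < 4
  0<4 = s≤s z≤n
  1<4 : 1 < 4
  1<4 = s≤s (s≤s z≤n)
  2<4 : 2 < 4
  2<4 = s≤s (s≤s (s≤s z≤n))
  3<4 : 3 < 4
  3<4 = ≤-refl
  -- vertex labels of u_i, v_i and w_i; the spine edge u_i u_{i+1} carries the label of v_i
  u v w spine : ℕ → ℕ
  u     = residue s 4 0
  v     = residue s 4 1
  w     = residue s 4 2
  spine = v
  block : ℕ → List ℕ
  block i = residue s 4 0 i ∷ residue s 4 2 i ∷ residue s 4 3 i ∷ []
  ψ-uv = juxtapose n u v
  ψ = juxtapose (n + r) ψ-uv w
  ψ-u : ∀ {i} → i < n → ψ i ≡ u i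
  ψ-u i<n = trans (juxtapose-left {n + r} {ψ-uv} {w} (≤-trans i<n (m≤m+n n r)))
                  (juxtapose-left {n} {u} {v} i<n)
  ψ-v : ∀ {i} → i < r → ψ (n + i) ≡ v i
  ψ-v {i} i<r = trans (juxtapose-left {n + r} {ψ-uv} {w} (+-monoʳ-< n i<r)) (juxtapose-right {n} {u} {v} i)
  ψ-w : ∀ i → ψ (n + r + i) ≡ w i
  ψ-w = juxtapose-right {n + r} {ψ-uv} {w}
  b≥1 : ∀ i → 1 ≤ u i
  b≥1 i = residue-positive 4 0 i 1≤s
  label< : ∀ {a i} → a < 4 → i < r → residue s 4 a i < s + r * 4
  label< a<4 i<r = +-monoʳ-< s (offset-below i<r a<4)
  u< : ∀ {i} → i < n → i < n + r + r
  u< i<n = ≤-trans i<n (≤-trans (m≤m+n n r) (m≤m+n (n + r) r))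
  v< : ∀ {i} → i < r → n + i < n + r + r
  v< i<r = ≤-trans (+-monoʳ-< n i<r) (m≤m+n (n + r) r)
  w< : ∀ {i} → i < r → n + r + i < n + r + r
  w< i<r = +-monoʳ-< (n + r) i<r
  ψ-next : ∀ {i} → i < r → ψ (suc i) ≡ 4 + u i
  ψ-next {i} i<r = trans (ψ-u (s≤s i<r)) (residue-next-index s 4 0 i)
  spine-edge : ∀ {i} → i < r → EdgeOK Admissible ψ (n + r + r) s (r * 4) (i , suc i) (spine i)
  spine-edge {i} i<r = edge-via (ψ-u (m<n⇒m<1+n i<r)) (ψ-next i<r) (u< (m<n⇒m<1+n i<r)) (u< (s≤s i<r))
    (inj₁ (subst (IsFloorSqrt _) (sym (residue-class s 4 1 i)) (floor-plus4 (u i) (b≥1 i))))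
    (m≤m+n s _) (label< 1<4 i<r)
  foot-edge : ∀ {i} → i < r → EdgeOK Admissible ψ (n + r + r) s (r * 4) (i , n + i) (residue s 4 0 i)
  foot-edge {i} i<r = edge-via (ψ-u (m<n⇒m<1+n i<r)) (trans (ψ-v i<r) (residue-class s 4 1 i))
    (u< (m<n⇒m<1+n i<r)) (v< i<r)
    (inj₁ (strict⇒floor (gap-succ (u i) (b≥1 i))))
    (m≤m+n s _) (label< 0<4 i<r)
  middle-edge : ∀ {i} → i < r →
    EdgeOK Admissible ψ (n + r + r) s (r * 4) (n + i , n + r + i) (residue s 4 2 i)
  middle-edge {i} i<r = edge-via (trans (ψ-v i<r) (residue-class s 4 1 i))
    (trans (ψ-w i) (residue-class s 4 2 i))
    (v< i<r) (w< i<r)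
    (inj₂ (subst (IsCeilSqrt _) (sym (residue-class s 4 2 i))
      (strict⇒ceil (gap-succ (suc (u i)) (s≤s z≤n)))))
    (m≤m+n s _) (label< 2<4 i<r)
  back-edge : ∀ {i} → i < r →
    EdgeOK Admissible ψ (n + r + r) s (r * 4) (n + r + i , suc i) (residue s 4 3 i)
  back-edge {i} i<r = edge-via (trans (ψ-w i) (residue-class s 4 2 i)) (ψ-next i<r)
    (w< i<r) (u< (s≤s i<r))
    (inj₂ (subst (IsCeilSqrt _) (sym (residue-class s 4 3 i))
      (strict⇒ceil (gap-succ² (2 + u i) (s≤s z≤n)))))
    (m≤m+n s _) (label< 3<4 i<r)
  hit : ∀ a i → a < 4 → a + i * 4 < r * 4 → residue s 4 a i ∈ snake-labels spine block r
  hit a i a<4 a+4i< = in-period a a<4 (offset-index {4} {a} {i} {r} a+4i<)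
    where
    in-period : ∀ a → a < 4 → i < r → residue s 4 a i ∈ snake-labels spine block r
    in-period 0 _ i<r = ∈-block i<r (here refl)
    in-period 1 _ i<r = ∈-spine i<r
    in-period 2 _ i<r = ∈-block i<r (there (here refl))
    in-period 3 _ i<r = ∈-block i<r (there (there (here refl)))
    in-period (suc (suc (suc (suc _)))) (s≤s (s≤s (s≤s (s≤s ())))) _

cyclic-labelling : ∀ s c → 1 ≤ s → 1 ≤ cycCompSize c →
  ∃ λ q → Labelling Admissible 0 s q (cycCompGraph c)
cyclic-labelling s (cycleC m) 1≤s 1≤m = m , cycle-labelling s m 1≤s 1≤m
cyclic-labelling s (crownC m) 1≤s 1≤m = m * 2 , crown-labelling s m 1≤s 1≤m

union-labelling : ∀ s → 1 ≤ s → ∀ cs → All (λ c → 1 ≤ cycCompSize c) cs →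
  ∃ λ q → Labelling Admissible 0 s q (unionAll cs)
union-labelling s 1≤s []       []           = 0 , empty-labelling s
union-labelling s 1≤s (c ∷ cs) (1≤c ∷ 1≤cs) =
  let (q₁ , L₁) = cyclic-labelling s c 1≤s 1≤c
      (q₂ , L₂) = union-labelling (s + q₁) (≤-trans 1≤s (m≤m+n s q₁)) cs 1≤cs
  in q₁ + q₂ , stack L₁ L₂

extra-labelling : ∀ s x → 1 ≤ s → 1 ≤ extraSize x →
  ∃ λ q → Labelling Admissible 1 s q (extraGraph x)
extra-labelling s (pathC (suc r)) 1≤s _ = r , relabel (inj₁ ∘ strict⇒floor) (path-labelling s r 1≤s)
extra-labelling s (combC (suc r)) 1≤s _ = _ , relabel (inj₁ ∘ strict⇒floor) (comb-labelling s r 1≤s)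
extra-labelling s (triC  (suc r)) 1≤s _ = _ , tri-labelling s r 1≤s
extra-labelling s (quadC (suc r)) 1≤s _ = _ , quad-labelling s r 1≤s

mainTheorem11 : (k : ℕ) → 1 ≤ k →
    (cs : List CycComp) → All (λ c → 3 ≤ cycCompSize c) cs →
    (ex : Maybe ExtraComp) → AllM (λ x → 1 ≤ extraSize x) ex →
    IsKGeometricMean k (buildGraph cs ex)
mainTheorem11 k 1≤k cs 3≤cs ex 1≤ex = geometric-mean (proj₂ (whole ex 1≤ex))
  where
  cycles = union-labelling k 1≤k cs (All.map (≤-trans (s≤s z≤n)) 3≤cs)
  whole : ∀ ex → AllM (λ x → 1 ≤ extraSize x) ex →
    ∃ λ q → Labelling Admissible 1 k q (buildGraph cs ex)
  whole nothing  nothing    = _ , add-slack (proj₂ cycles)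
  whole (just x) (just 1≤x) =
    _ , stack (proj₂ cycles)
          (proj₂ (extra-labelling (k + proj₁ cycles) x (≤-trans 1≤k (m≤m+n k _)) 1≤x))
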